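{- Let $\alpha$ be an odd positive norm-perfect Eisenstein integer, and suppose $$\alpha=\psi_0^k\prod_{\psi_1\in P_1,\,\psi_1\ne\psi_0}\psi_1^{e_{\psi_1}}\prod_{\psi_2\in P_2,\,\psi_2\ne\psi_0}\psi_2^{e_{\psi_2}}$$ where either ($\psi_0\in P_1$ and $k\equiv 2\pmod 3$) or ($\psi_0\in P_2$ and $k\equiv 1\pmod 2$), and $e_{\psi_1}\not\equiv 2\pmod 3$, $e_{\psi_2}\equiv 0\pmod 2$ for the primes in the products. Then $\psi_0\in P_1$ if and only if $\alpha\equiv 1\pmod{1-\omega^2}$ (and $\psi_0\in P_2$ if and only if $\alpha\equiv 2\pmod{1-\omega^2}$).
   Context: $\omega=e^{2\pi i/3}$, $N(a+b\omega)=a^2-ab+b^2$, $\mathbb{Z}[\omega]/(1-\omega^2)\cong\mathbb{Z}/3\mathbb{Z}$. Positive primes: $\mathbb{P}^+=\{a+b\omega: a>b\ge 0\}\cap\{\text{primes of }\mathbb{Z}[\omega]\}$; a positive integer is a product of positive primes. $P_j=\{\psi\in\mathbb{P}^+:\psi\equiv j\pmod{1-\omega^2},\ \psi\mid\alpha\}$ for $j\in\{1,2\}$. For nonzero $\alpha=\varepsilon\prod\pi_j^{e_j}$, $\sigma(\alpha)=\prod\frac{\pi_j^{e_j+1}-1}{\pi_j-1}$. Odd means not divisible by $1-\omega^2$; norm-perfect means $N(\sigma(\alpha))=3N(\alpha)$. (Every odd norm-perfect Eisenstein integer admits such a representation, with a unit factor in general.) -}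

module Defs where

open import Data.Nat using (ℕ; zero; suc)
open import Data.Integer as ℤ using (ℤ; +_; +0)
open import Data.Product using (Σ; _×_; _,_; proj₁; ∃)
open import Data.Sum using (_⊎_)
open import Data.List using (List; []; _∷_)
open import Relation.Binary.PropositionalEquality using (_≡_)
open import Relation.Nullary using (¬_)

-- Eisenstein integer a + b ω, with ω = e^{2πi/3}, ω² = -1 - ω.
record 𝔼 : Set where
  constructor _+_ω
  field
    re : ℤ
    im : ℤ
open 𝔼 public

infixl 6 _+ᴱ_ _-ᴱ_
infixl 7 _*ᴱ_
infixr 8 _^ᴱ_

0ᴱ 1ᴱ ω : 𝔼
0ᴱ = +0 + +0 ω
1ᴱ = (+ 1) + +0 ω
ω  = +0 + (+ 1) ω

ι : ℤ → 𝔼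
ι n = n + +0 ω

_+ᴱ_ : 𝔼 → 𝔼 → 𝔼
(a + b ω) +ᴱ (c + d ω) = (a ℤ.+ c) + (b ℤ.+ d) ω

-ᴱ_ : 𝔼 → 𝔼
-ᴱ (a + b ω) = (ℤ.- a) + (ℤ.- b) ω

_-ᴱ_ : 𝔼 → 𝔼 → 𝔼
x -ᴱ y = x +ᴱ (-ᴱ y)

-- (a + bω)(c + dω) = (ac - bd) + (ad + bc - bd)ω   (using ω² = -1 - ω)
_*ᴱ_ : 𝔼 → 𝔼 → 𝔼
(a + b ω) *ᴱ (c + d ω) =
  (a ℤ.* c ℤ.- b ℤ.* d) + (a ℤ.* d ℤ.+ b ℤ.* c ℤ.- b ℤ.* d) ω

_^ᴱ_ : 𝔼 → ℕ → 𝔼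
x ^ᴱ zero  = 1ᴱ
x ^ᴱ suc n = x *ᴱ (x ^ᴱ n)

N : 𝔼 → ℤ
N (a + b ω) = a ℤ.* a ℤ.- a ℤ.* b ℤ.+ b ℤ.* b

_∣ᴱ_ : 𝔼 → 𝔼 → Set
x ∣ᴱ y = ∃ λ q → q *ᴱ x ≡ y

Unit : 𝔼 → Set
Unit u = ∃ λ v → u *ᴱ v ≡ 1ᴱ

Prime : 𝔼 → Set
Prime p = (¬ p ≡ 0ᴱ) × (¬ Unit p) ×
          (∀ x y → p ∣ᴱ (x *ᴱ y) → (p ∣ᴱ x) ⊎ (p ∣ᴱ y))

PositivePrime : 𝔼 → Set
PositivePrime p = (im p ℤ.< re p) × (+0 ℤ.≤ im p) × Prime p

λ₀ : 𝔼
λ₀ = 1ᴱ -ᴱ (ω *ᴱ ω)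

_≡_[mod_] : 𝔼 → 𝔼 → 𝔼 → Set
x ≡ y [mod m ] = m ∣ᴱ (x -ᴱ y)

Odd : 𝔼 → Set
Odd α = ¬ (λ₀ ∣ᴱ α)

InP : ℕ → 𝔼 → 𝔼 → Set
InP j α ψ = PositivePrime ψ × (ψ ≡ ι (+ j) [mod λ₀ ]) × (ψ ∣ᴱ α)

geom : 𝔼 → ℕ → 𝔼
geom π zero    = 1ᴱ
geom π (suc e) = geom π e +ᴱ π ^ᴱ suc e

Factorization : Set
Factorization = List (𝔼 × ℕ)

prodF : Factorization → 𝔼
prodF []             = 1ᴱ
prodF ((π , e) ∷ fs) = (π ^ᴱ e) *ᴱ prodF fs

-- σ computed from a factorization: ∏ (π^{e+1}-1)/(π-1)
σF : Factorization → 𝔼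
σF []             = 1ᴱ
σF ((π , e) ∷ fs) = geom π e *ᴱ σF fs

-- Reduction modulo λ₀ = 1 - ω² = 2 + ω sends a + bω to a + b mod 3, a ring map
-- ℤ[ω] → ℤ/3. Since α is odd, every prime factor has residue 1 or 2, and those of
-- residue 2 occur to even powers, so the cofactor of ψ₀ᵏ has residue 1. Hence α has
-- the residue of ψ₀ᵏ, which is that of ψ₀: trivially for residue 1, and because k is
-- odd for residue 2.
module Submission where

open import Defs
open import Data.Nat using (ℕ; _%_; _≤_)
open import Data.Integer as ℤ using (+_)
open import Data.Product using (_×_; _,_; proj₁; proj₂)
open import Data.Sum using (_⊎_)
open import Data.List using (List; _∷_; map)
open import Data.List.Relation.Unary.All using (All)
open import Data.List.Relation.Unary.Unique.Propositional using (Unique)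
open import Relation.Binary.PropositionalEquality using (_≡_)
open import Relation.Nullary using (¬_)
open import Function.Bundles using (_⇔_)

import Data.Nat as ℕ
open import Data.Integer using (ℤ; _*_; _-_; -_)
open import Data.Integer.Properties using (+-inverseʳ; +-identityʳ; *-identityʳ; *-zeroʳ; +-minus-telescope)
open import Data.Integer.DivMod using (_%ℕ_; _/ℕ_; n%ℕd<d; a≡a%ℕn+[a/ℕn]*n)
open import Data.Integer.Divisibility.Signed
  using (_∣_; divides; _∣?_; ∣m∣n⇒∣m+n; ∣m⇒∣-m; ∣n⇒∣m*n; ∣m⇒∣m*n)
open import Data.Integer.Tactic.RingSolver using (solve-∀)
open import Data.Sum using (inj₁; inj₂)
open import Data.Empty using (⊥-elim)
open import Data.List using ([])
open import Data.List.Relation.Unary.All using ([]; _∷_)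
import Data.List.Relation.Unary.All as All
open import Relation.Binary.PropositionalEquality
  using (refl; sym; trans; cong; cong₂; subst; module ≡-Reasoning)
open import Relation.Nullary.Decidable.Core using (from-no)
open import Function.Base using (const)
open import Function.Bundles using (mk⇔)

private
  _+ℤ_ : ℤ → ℤ → ℤ
  _+ℤ_ = ℤ._+_
  infixl 6 _+ℤ_

*ᴱ-assoc : ∀ x y z → (x *ᴱ y) *ᴱ z ≡ x *ᴱ (y *ᴱ z)
*ᴱ-assoc (a + b ω) (c + d ω) (e + f ω) = cong₂ _+_ω (re-assoc a b c d e f) (im-assoc a b c d e f)
  where
  re-assoc : ∀ a b c d e f →
    (a * c - b * d) * e - (a * d +ℤ b * c - b * d) * f ≡
    a * (c * e - d * f) - b * (c * f +ℤ d * e - d * f)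
  re-assoc = solve-∀
  im-assoc : ∀ a b c d e f →
    (a * c - b * d) * f +ℤ (a * d +ℤ b * c - b * d) * e - (a * d +ℤ b * c - b * d) * f ≡
    a * (c * f +ℤ d * e - d * f) +ℤ b * (c * e - d * f) - b * (c * f +ℤ d * e - d * f)
  im-assoc = solve-∀

*ᴱ-comm : ∀ x y → x *ᴱ y ≡ y *ᴱ x
*ᴱ-comm (a + b ω) (c + d ω) = cong₂ _+_ω (re-comm a b c d) (im-comm a b c d)
  where
  re-comm : ∀ a b c d → a * c - b * d ≡ c * a - d * b
  re-comm = solve-∀
  im-comm : ∀ a b c d → a * d +ℤ b * c - b * d ≡ c * b +ℤ d * a - d * b
  im-comm = solve-∀

-ᴱ-identityʳ : ∀ x → x -ᴱ 0ᴱ ≡ x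
-ᴱ-identityʳ (a + b ω) = cong₂ _+_ω (+-identityʳ a) (+-identityʳ b)

∣ᴱ-trans : ∀ {x y z} → x ∣ᴱ y → y ∣ᴱ z → x ∣ᴱ z
∣ᴱ-trans {x} (q , qx≡y) (r , ry≡z) = r *ᴱ q , trans (*ᴱ-assoc r q x) (trans (cong (r *ᴱ_) qx≡y) ry≡z)

∣ᴱ-*ᴱʳ : ∀ x y → x ∣ᴱ (x *ᴱ y)
∣ᴱ-*ᴱʳ x y = y , *ᴱ-comm y x

-- A record rather than a synonym for 3 ∣ i - j, so that i and j are inferable.
infix 4 _≡₃_
record _≡₃_ (i j : ℤ) : Set where
  constructor mk≡₃
  field 3∣i-j : + 3 ∣ i - j

≡₃-refl : ∀ i → i ≡₃ i
≡₃-refl i = mk≡₃ (divides (+ 0) (+-inverseʳ i))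

≡₃-sym : ∀ {i j} → i ≡₃ j → j ≡₃ i
≡₃-sym {i} {j} (mk≡₃ 3∣i-j) = mk≡₃ (subst (+ 3 ∣_) (swap-minus i j) (∣m⇒∣-m 3∣i-j))
  where
  swap-minus : ∀ i j → - (i - j) ≡ j - i
  swap-minus = solve-∀

≡₃-trans : ∀ {i j k} → i ≡₃ j → j ≡₃ k → i ≡₃ k
≡₃-trans {i} {j} {k} (mk≡₃ p) (mk≡₃ q) = mk≡₃ (subst (+ 3 ∣_) (+-minus-telescope i j k) (∣m∣n⇒∣m+n p q))

≡₃-*-cong : ∀ {i j k l} → i ≡₃ j → k ≡₃ l → i * k ≡₃ j * l
≡₃-*-cong {i} {j} {k} {l} (mk≡₃ p) (mk≡₃ q) =
  mk≡₃ (subst (+ 3 ∣_) (sym (split i j k l)) (∣m∣n⇒∣m+n (∣n⇒∣m*n i q) (∣m⇒∣m*n l p)))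
  where
  split : ∀ i j k l → i * k - j * l ≡ i * (k - l) +ℤ (i - j) * l
  split = solve-∀

≡₃-%ℕ : ∀ i → i ≡₃ + (i %ℕ 3)
≡₃-%ℕ i = mk≡₃ (divides (i /ℕ 3) (begin
  i - + r                        ≡⟨ cong (_- + r) (a≡a%ℕn+[a/ℕn]*n i 3) ⟩
  (+ r +ℤ (i /ℕ 3) * + 3) - + r  ≡⟨ cancel (+ r) (i /ℕ 3) ⟩
  (i /ℕ 3) * + 3                 ∎))
  where
  open ≡-Reasoning
  r = i %ℕ 3
  cancel : ∀ r q → (r +ℤ q * + 3) - r ≡ q * + 3
  cancel = solve-∀

≡₃-trichotomy : ∀ i → i ≡₃ + 0 ⊎ i ≡₃ + 1 ⊎ i ≡₃ + 2
≡₃-trichotomy i = by-remainder (i %ℕ 3) (n%ℕd<d i 3) (≡₃-%ℕ i)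
  where
  by-remainder : ∀ r → r ℕ.< 3 → i ≡₃ + r → i ≡₃ + 0 ⊎ i ≡₃ + 1 ⊎ i ≡₃ + 2
  by-remainder 0 _ p = inj₁ p
  by-remainder 1 _ p = inj₂ (inj₁ p)
  by-remainder 2 _ p = inj₂ (inj₂ p)
  by-remainder (ℕ.suc (ℕ.suc (ℕ.suc _))) (ℕ.s≤s (ℕ.s≤s (ℕ.s≤s ()))) _

1≢₃2 : ¬ (+ 1 ≡₃ + 2)
1≢₃2 (mk≡₃ 3∣-1) = from-no (+ 3 ∣? (+ 1 - + 2)) 3∣-1

-- ω ≡ 1 (mod λ₀), since ω - 1 = λ₀ - 3 and λ₀ ∣ 3.
residue : 𝔼 → ℤ
residue (a + b ω) = a +ℤ b

residue-*ᴱ : ∀ x y → residue (x *ᴱ y) ≡₃ residue x * residue y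
residue-*ᴱ (a + b ω) (c + d ω) = mk≡₃ (divides (- (b * d)) (expand a b c d))
  where
  expand : ∀ a b c d →
    (a * c - b * d) +ℤ (a * d +ℤ b * c - b * d) - (a +ℤ b) * (c +ℤ d) ≡ - (b * d) * + 3
  expand = solve-∀

residue-cong-*ᴱ : ∀ x y {r s} → residue x ≡₃ r → residue y ≡₃ s → residue (x *ᴱ y) ≡₃ r * s
residue-cong-*ᴱ x y p q = ≡₃-trans (residue-*ᴱ x y) (≡₃-*-cong p q)

residue-ι : ∀ n → residue (ι n) ≡ n
residue-ι = +-identityʳ

residue-*ᴱ-≡₃1ʳ : ∀ x y → residue y ≡₃ + 1 → residue (x *ᴱ y) ≡₃ residue x
residue-*ᴱ-≡₃1ʳ x y y≡1 =
  subst (residue (x *ᴱ y) ≡₃_) (*-identityʳ (residue x)) (residue-cong-*ᴱ x y (≡₃-refl (residue x)) y≡1)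

mod-λ₀⇒residue-≡₃ : ∀ x y → x ≡ y [mod λ₀ ] → residue x ≡₃ residue y
mod-λ₀⇒residue-≡₃ (a + b ω) (c + d ω) (s + t ω , q*λ₀≡x-y) = mk≡₃ (divides s (begin
  (a +ℤ b) - (c +ℤ d)                        ≡⟨ regroup a b c d ⟩
  (a - c) +ℤ (b - d)                         ≡⟨ cong residue (sym q*λ₀≡x-y) ⟩
  (s * + 2 - t * + 1) +ℤ (s * + 1 +ℤ t * + 2 - t * + 1) ≡⟨ collapse s t ⟩
  s * + 3                                    ∎))
  where
  open ≡-Reasoning
  regroup : ∀ a b c d → (a +ℤ b) - (c +ℤ d) ≡ (a - c) +ℤ (b - d)
  regroup = solve-∀
  collapse : ∀ s t → (s * + 2 - t * + 1) +ℤ (s * + 1 +ℤ t * + 2 - t * + 1) ≡ s * + 3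
  collapse = solve-∀

-- The quotient s + tω solves (2s - t, s + t) = (a - c, b - d), with 3s = a + b - c - d.
residue-≡₃⇒mod-λ₀ : ∀ x y → residue x ≡₃ residue y → x ≡ y [mod λ₀ ]
residue-≡₃⇒mod-λ₀ (a + b ω) (c + d ω) (mk≡₃ (divides m a+b-c-d≡3m)) =
  m + ((b - d) - m) ω , cong₂ _+_ω re-part (im-part m b d)
  where
  open ≡-Reasoning
  re-part : m * + 2 - ((b - d) - m) * + 1 ≡ a - c
  re-part = begin
    m * + 2 - ((b - d) - m) * + 1          ≡⟨ unfold m b d ⟩
    m * + 3 - (b - d)                      ≡⟨ cong (_- (b - d)) (sym a+b-c-d≡3m) ⟩
    ((a +ℤ b) - (c +ℤ d)) - (b - d)        ≡⟨ cancel a b c d ⟩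
    a - c                                  ∎
    where
    unfold : ∀ m b d → m * + 2 - ((b - d) - m) * + 1 ≡ m * + 3 - (b - d)
    unfold = solve-∀
    cancel : ∀ a b c d → ((a +ℤ b) - (c +ℤ d)) - (b - d) ≡ a - c
    cancel = solve-∀
  im-part : ∀ m b d → m * + 1 +ℤ ((b - d) - m) * + 2 - ((b - d) - m) * + 1 ≡ b - d
  im-part = solve-∀

InP⇒residue-≡₃ : ∀ j α ψ → InP j α ψ → residue ψ ≡₃ + j
InP⇒residue-≡₃ j α ψ (_ , ψ≡j , _) =
  subst (residue ψ ≡₃_) (residue-ι (+ j)) (mod-λ₀⇒residue-≡₃ ψ (ι (+ j)) ψ≡j)

mod-λ₀-1≢2 : ∀ x → x ≡ ι (+ 1) [mod λ₀ ] → ¬ (x ≡ ι (+ 2) [mod λ₀ ])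
mod-λ₀-1≢2 x x≡1 x≡2 =
  1≢₃2 (≡₃-trans (≡₃-sym (mod-λ₀⇒residue-≡₃ x (ι (+ 1)) x≡1)) (mod-λ₀⇒residue-≡₃ x (ι (+ 2)) x≡2))

odd-divisor-residue-≢₃0 : ∀ {α π} → Odd α → π ∣ᴱ α → ¬ (residue π ≡₃ + 0)
odd-divisor-residue-≢₃0 {α} {π} odd (q , qπ≡α) π≡0 =
  odd (subst (λ₀ ∣ᴱ_) (-ᴱ-identityʳ α) (residue-≡₃⇒mod-λ₀ α 0ᴱ α≡0))
  where
  α≡0 : residue α ≡₃ + 0
  α≡0 = subst (λ z → residue z ≡₃ + 0) qπ≡α
          (subst (residue (q *ᴱ π) ≡₃_) (*-zeroʳ (residue q))
            (residue-cong-*ᴱ q π (≡₃-refl (residue q)) π≡0))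

residue-^ᴱ-of-1 : ∀ x → residue x ≡₃ + 1 → ∀ e → residue (x ^ᴱ e) ≡₃ + 1
residue-^ᴱ-of-1 x x≡1 ℕ.zero    = ≡₃-refl (+ 1)
residue-^ᴱ-of-1 x x≡1 (ℕ.suc e) = residue-cong-*ᴱ x (x ^ᴱ e) x≡1 (residue-^ᴱ-of-1 x x≡1 e)

residue-^ᴱ-of-2-+2 : ∀ x → residue x ≡₃ + 2 → ∀ e → residue (x ^ᴱ (2 ℕ.+ e)) ≡₃ residue (x ^ᴱ e)
residue-^ᴱ-of-2-+2 x x≡2 e =
  ≡₃-trans (residue-cong-*ᴱ x _ x≡2 (residue-cong-*ᴱ x (x ^ᴱ e) x≡2 (≡₃-refl (residue (x ^ᴱ e)))))
           (mk≡₃ (divides r (four-times r)))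
  where
  r = residue (x ^ᴱ e)
  four-times : ∀ r → + 2 * (+ 2 * r) - r ≡ r * + 3
  four-times = solve-∀

residue-^ᴱ-of-2-even : ∀ x → residue x ≡₃ + 2 → ∀ e → e % 2 ≡ 0 → residue (x ^ᴱ e) ≡₃ + 1
residue-^ᴱ-of-2-even x x≡2 0                   _  = ≡₃-refl (+ 1)
residue-^ᴱ-of-2-even x x≡2 (ℕ.suc (ℕ.suc e)) even =
  ≡₃-trans (residue-^ᴱ-of-2-+2 x x≡2 e) (residue-^ᴱ-of-2-even x x≡2 e even)

residue-^ᴱ-of-2-odd : ∀ x → residue x ≡₃ + 2 → ∀ e → e % 2 ≡ 1 → residue (x ^ᴱ e) ≡₃ + 2
residue-^ᴱ-of-2-odd x x≡2 1                 _  = residue-cong-*ᴱ x 1ᴱ x≡2 (≡₃-refl (+ 1))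
residue-^ᴱ-of-2-odd x x≡2 (ℕ.suc (ℕ.suc e)) odd =
  ≡₃-trans (residue-^ᴱ-of-2-+2 x x≡2 e) (residue-^ᴱ-of-2-odd x x≡2 e odd)

residue-prime-power-≡₃1 : ∀ {α π} e → Odd α → PositivePrime π → π ∣ᴱ α →
  (InP 2 α π → e % 2 ≡ 0) → residue (π ^ᴱ e) ≡₃ + 1
residue-prime-power-≡₃1 {α} {π} e odd prime π∣α even-if-2 with ≡₃-trichotomy (residue π)
... | inj₁ π≡0        = ⊥-elim (odd-divisor-residue-≢₃0 odd π∣α π≡0)
... | inj₂ (inj₁ π≡1) = residue-^ᴱ-of-1 π π≡1 e
... | inj₂ (inj₂ π≡2) =
  residue-^ᴱ-of-2-even π π≡2 e (even-if-2 (prime , residue-≡₃⇒mod-λ₀ π (ι (+ 2)) π≡2 , π∣α))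

residue-prodF-≡₃1 : ∀ {α} fs → Odd α → prodF fs ∣ᴱ α →
  All (λ pe → PositivePrime (proj₁ pe)) fs →
  All (λ pe → 1 ≤ proj₂ pe) fs →
  All (λ pe → InP 2 α (proj₁ pe) → proj₂ pe % 2 ≡ 0) fs →
  residue (prodF fs) ≡₃ + 1
residue-prodF-≡₃1 [] _ _ _ _ _ = ≡₃-refl (+ 1)
residue-prodF-≡₃1 {α} ((π , ℕ.suc e) ∷ fs) odd πᵉP∣α (prime ∷ primes) (_ ∷ positive) (even ∷ evens) =
  residue-cong-*ᴱ (π ^ᴱ ℕ.suc e) P
    (residue-prime-power-≡₃1 (ℕ.suc e) odd prime π∣α even)
    (residue-prodF-≡₃1 fs odd P∣α primes positive evens)
  where
  P = prodF fs
  π∣α : π ∣ᴱ α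
  π∣α = ∣ᴱ-trans (∣ᴱ-*ᴱʳ π (π ^ᴱ e)) (∣ᴱ-trans (∣ᴱ-*ᴱʳ (π ^ᴱ ℕ.suc e) P) πᵉP∣α)
  P∣α : P ∣ᴱ α
  P∣α = ∣ᴱ-trans (π ^ᴱ ℕ.suc e , refl) πᵉP∣α

mainTheorem12 : (α ψ₀ : 𝔼) (k : ℕ) (rest : Factorization) →
    PositivePrime ψ₀ →
    All (λ pe → PositivePrime (proj₁ pe)) rest →
    All (λ pe → 1 ≤ proj₂ pe) rest →
    Unique (ψ₀ ∷ map proj₁ rest) →
    α ≡ (ψ₀ ^ᴱ k) *ᴱ prodF rest →
    Odd α →
    N (σF ((ψ₀ , k) ∷ rest)) ≡ + 3 ℤ.* N α →
    ((InP 1 α ψ₀ × k % 3 ≡ 2) ⊎ (InP 2 α ψ₀ × k % 2 ≡ 1)) →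
    All (λ pe → (InP 1 α (proj₁ pe) → ¬ (proj₂ pe % 3 ≡ 2)) ×
    (InP 2 α (proj₁ pe) → proj₂ pe % 2 ≡ 0)) rest →
    (InP 1 α ψ₀ ⇔ (α ≡ ι (+ 1) [mod λ₀ ])) ×
    (InP 2 α ψ₀ ⇔ (α ≡ ι (+ 2) [mod λ₀ ]))
mainTheorem12 α ψ₀ k rest _ primes positive _ α≡ψ₀ᵏP odd _ ψ₀-case exponents = by-case ψ₀-case
  where
  residue-α : residue α ≡₃ residue (ψ₀ ^ᴱ k)
  residue-α = subst (λ z → residue z ≡₃ residue (ψ₀ ^ᴱ k)) (sym α≡ψ₀ᵏP)
    (residue-*ᴱ-≡₃1ʳ (ψ₀ ^ᴱ k) (prodF rest)
      (residue-prodF-≡₃1 rest odd (ψ₀ ^ᴱ k , sym α≡ψ₀ᵏP) primes positive (All.map proj₂ exponents)))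
  α≡ψ₀ᵏ : ∀ {r} → residue (ψ₀ ^ᴱ k) ≡₃ + r → α ≡ ι (+ r) [mod λ₀ ]
  α≡ψ₀ᵏ {r} ψ₀ᵏ≡r = residue-≡₃⇒mod-λ₀ α (ι (+ r))
    (subst (residue α ≡₃_) (sym (residue-ι (+ r))) (≡₃-trans residue-α ψ₀ᵏ≡r))
  by-case : ((InP 1 α ψ₀ × k % 3 ≡ 2) ⊎ (InP 2 α ψ₀ × k % 2 ≡ 1)) →
    (InP 1 α ψ₀ ⇔ (α ≡ ι (+ 1) [mod λ₀ ])) × (InP 2 α ψ₀ ⇔ (α ≡ ι (+ 2) [mod λ₀ ]))
  by-case (inj₁ (ψ₀∈P₁ , _)) =
    mk⇔ (const α≡1) (const ψ₀∈P₁) ,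
    mk⇔ (λ ψ₀∈P₂ → ⊥-elim (mod-λ₀-1≢2 ψ₀ (proj₁ (proj₂ ψ₀∈P₁)) (proj₁ (proj₂ ψ₀∈P₂))))
        (λ α≡2 → ⊥-elim (mod-λ₀-1≢2 α α≡1 α≡2))
    where
    α≡1 = α≡ψ₀ᵏ (residue-^ᴱ-of-1 ψ₀ (InP⇒residue-≡₃ 1 α ψ₀ ψ₀∈P₁) k)
  by-case (inj₂ (ψ₀∈P₂ , k-odd)) =
    mk⇔ (λ ψ₀∈P₁ → ⊥-elim (mod-λ₀-1≢2 ψ₀ (proj₁ (proj₂ ψ₀∈P₁)) (proj₁ (proj₂ ψ₀∈P₂))))
        (λ α≡1 → ⊥-elim (mod-λ₀-1≢2 α α≡1 α≡2)) ,
    mk⇔ (const α≡2) (const ψ₀∈P₂)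
    where
    α≡2 = α≡ψ₀ᵏ (residue-^ᴱ-of-2-odd ψ₀ (InP⇒residue-≡₃ 2 α ψ₀ ψ₀∈P₂) k k-odd)
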